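{- Fix $k\in\mathbb Z_{\ge0}$. For every $k$-MM triple $(X,Y,Z)$, with $\Psi(A,B,C):=(\psi(A),\psi(B),\psi(C))$, \[\Psi(X,YZY^{ -1},Y)=(\psi(X),\psi(X)\psi(Y)-S,\psi(Y)),\qquad \Psi(Y,Y^{ -1}XY,Z)=(\psi(Y),\psi(Y)\psi(Z)-S,\psi(Z)).\]
   Context: Fix $k\in\mathbb Z_{\ge0}$. A $k$-GM triple is $(a,b,c)\in\mathbb Z_{\ge1}^3$ with $a^2+b^2+c^2+k(bc+ca+ab)=(3+3k)abc$; a $k$-GM number is an entry of some $k$-GM triple. Let $S=\begin{bmatrix}k&0\\3k^2+3k&k\end{bmatrix}$, $T=\begin{bmatrix}-1&0\\3k+3&-1\end{bmatrix}$. A $k$-MM matrix is $X\in SL(2,\mathbb Z)$ whose $(1,2)$-entry is a $k$-GM number and $\operatorname{tr}X=-k$; a $k$-MM triple is a triple $(X,Y,Z)$ of $k$-MM matrices with $XYZ=T$ whose $(1,2)$-entries form a $k$-GM triple. The map $\psi\colon M(2,\mathbb Z)\to M(2,\mathbb Z)$ is \[\psi\begin{bmatrix} m_{11}&m_{12}\\ m_{21}&m_{22}\end{bmatrix}=\begin{bmatrix} -m_{11}+m_{12}k-k & m_{12}\\ m_{21}-(k+3)m_{11}+k(2k+3)(m_{12}-1) & -m_{22}+(2k+3)m_{12}-k\end{bmatrix}.\] -}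

module Defs where

open import Data.Nat using (ℕ)
open import Data.Integer using (ℤ; +_; _+_; _-_; _*_; -_; 0ℤ; 1ℤ)
open import Data.Product using (Σ; ∃; _×_; _,_)
open import Data.Sum using (_⊎_)
open import Relation.Binary.PropositionalEquality using (_≡_)

record Mat2 : Set where
  constructor mat
  field
    m11 m12 m21 m22 : ℤ
open Mat2 public

infixl 7 _⊗_
_⊗_ : Mat2 → Mat2 → Mat2
mat a b c d ⊗ mat e f g h = mat (a * e + b * g) (a * f + b * h) (c * e + d * g) (c * f + d * h)

infixl 6 _⊖_
_⊖_ : Mat2 → Mat2 → Mat2
mat a b c d ⊖ mat e f g h = mat (a - e) (b - f) (c - g) (d - h)

det : Mat2 → ℤ
det (mat a b c d) = a * d - b * c

tr : Mat2 → ℤ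
tr (mat a b c d) = a + d

-- inverse in SL(2,ℤ) (adjugate; equals the inverse whenever det = 1)
inv : Mat2 → Mat2
inv (mat a b c d) = mat d (- b) (- c) a

InSL2 : Mat2 → Set
InSL2 X = det X ≡ 1ℤ

module _ (k : ℕ) where
  private
    κ : ℤ
    κ = + k

  IsGMTriple : ℤ → ℤ → ℤ → Set
  IsGMTriple a b c =
    (Data.Integer._≤_ 1ℤ a × Data.Integer._≤_ 1ℤ b × Data.Integer._≤_ 1ℤ c) ×
    (a * a + b * b + c * c + κ * (b * c + c * a + a * b) ≡ (+ 3 + + 3 * κ) * a * b * c)

  IsGMNumber : ℤ → Set
  IsGMNumber x = Σ ℤ λ b → Σ ℤ λ c →
    IsGMTriple x b c ⊎ IsGMTriple b x c ⊎ IsGMTriple b c x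

  Smat : Mat2
  Smat = mat κ 0ℤ (+ 3 * κ * κ + + 3 * κ) κ

  Tmat : Mat2
  Tmat = mat (- 1ℤ) 0ℤ (+ 3 * κ + + 3) (- 1ℤ)

  IsMMMatrix : Mat2 → Set
  IsMMMatrix X = InSL2 X × IsGMNumber (m12 X) × (tr X ≡ - κ)

  IsMMTriple : Mat2 → Mat2 → Mat2 → Set
  IsMMTriple X Y Z =
    IsMMMatrix X × IsMMMatrix Y × IsMMMatrix Z ×
    (X ⊗ Y ⊗ Z ≡ Tmat) × IsGMTriple (m12 X) (m12 Y) (m12 Z)

  ψ : Mat2 → Mat2
  ψ (mat a b c d) =
    mat (- a + b * κ - κ)
        b
        (c - (κ + + 3) * a + κ * (+ 2 * κ + + 3) * (b - 1ℤ))
        (- d + (+ 2 * κ + + 3) * b - κ)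

{-# OPTIONS --safe #-}
-- On matrices of trace -κ the map ψ is affine: ψ M = L (M + κ) R = L M R - S, and
-- there M + κ = -M⁻¹ (M⁻¹ the adjugate), so also ψ M = -L M⁻¹ R.  Since R L = T,
-- ψ A ψ B - S = L A⁻¹ (R L) B⁻¹ R - S = ψ (A⁻¹ T B⁻¹) whenever A⁻¹ T B⁻¹ has trace -κ.
-- For an MM triple, X Y Z = T turns Y Z Y⁻¹ into X⁻¹ T Y⁻¹ and Y⁻¹ X Y into Y⁻¹ T Z⁻¹,
-- conjugates of Z and X.
module Submission where

open import Defs
open import Data.Nat using (ℕ)
open import Data.Integer using (ℤ; +_; _+_; _-_; _*_; -_; 0ℤ; 1ℤ)
open import Data.Integer.Properties using (*-identityˡ)
open import Data.Integer.Tactic.RingSolver using (solve-∀)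
open import Data.Product using (_×_; _,_)
open import Relation.Binary.PropositionalEquality
  using (_≡_; refl; sym; trans; cong; cong₂; subst; module ≡-Reasoning)
open ≡-Reasoning

mat-cong : ∀ {a b c d a′ b′ c′ d′} → a ≡ a′ → b ≡ b′ → c ≡ c′ → d ≡ d′ →
           mat a b c d ≡ mat a′ b′ c′ d′
mat-cong refl refl refl refl = refl

infix 8 ⊝_
⊝_ : Mat2 → Mat2
⊝ mat a b c d = mat (- a) (- b) (- c) (- d)

-- The entry identities solved below are written in exactly the shape to which the
-- matrix operations unfold, so that they match the goals definitionally.
⊗-assoc : ∀ A B C → A ⊗ B ⊗ C ≡ A ⊗ (B ⊗ C)
⊗-assoc (mat a b c d) (mat e f g h) (mat p q r s) =
  mat-cong (row-column a b e f g h p r) (row-column a b e f g h q s)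
           (row-column c d e f g h p r) (row-column c d e f g h q s)
  where
  row-column : ∀ a b e f g h p r →
    (a * e + b * g) * p + (a * f + b * h) * r ≡ a * (e * p + f * r) + b * (g * p + h * r)
  row-column = solve-∀

⊝-⊗-⊝ : ∀ A B → ⊝ A ⊗ ⊝ B ≡ A ⊗ B
⊝-⊗-⊝ (mat a b c d) (mat e f g h) =
  mat-cong (entry a b e g) (entry a b f h) (entry c d e g) (entry c d f h)
  where
  entry : ∀ a b e g → - a * - e + - b * - g ≡ a * e + b * g
  entry = solve-∀

det≡1⇒det*x≡x : ∀ A x → det A ≡ 1ℤ → det A * x ≡ x
det≡1⇒det*x≡x A x detA≡1 = trans (cong (_* x) detA≡1) (*-identityˡ x)

inv-⊗-cancelˡ : ∀ A B → det A ≡ 1ℤ → inv A ⊗ (A ⊗ B) ≡ B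
inv-⊗-cancelˡ A@(mat a b c d) (mat p q r s) detA≡1 =
  mat-cong (trans (row₁ a b c d p r) (scale p)) (trans (row₁ a b c d q s) (scale q))
           (trans (row₂ a b c d p r) (scale r)) (trans (row₂ a b c d q s) (scale s))
  where
  scale : ∀ x → det A * x ≡ x
  scale x = det≡1⇒det*x≡x A x detA≡1
  row₁ : ∀ a b c d p r → d * (a * p + b * r) + - b * (c * p + d * r) ≡ (a * d - b * c) * p
  row₁ = solve-∀
  row₂ : ∀ a b c d p r → - c * (a * p + b * r) + a * (c * p + d * r) ≡ (a * d - b * c) * r
  row₂ = solve-∀

⊗-inv-cancelʳ : ∀ A B → det B ≡ 1ℤ → A ⊗ B ⊗ inv B ≡ A
⊗-inv-cancelʳ (mat a b c d) B@(mat e f g h) detB≡1 =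
  mat-cong (trans (column₁ a b e f g h) (scale a)) (trans (column₂ a b e f g h) (scale b))
           (trans (column₁ c d e f g h) (scale c)) (trans (column₂ c d e f g h) (scale d))
  where
  scale : ∀ x → det B * x ≡ x
  scale x = det≡1⇒det*x≡x B x detB≡1
  column₁ : ∀ a b e f g h → (a * e + b * g) * h + (a * f + b * h) * - g ≡ (e * h - f * g) * a
  column₁ = solve-∀
  column₂ : ∀ a b e f g h → (a * e + b * g) * - f + (a * f + b * h) * e ≡ (e * h - f * g) * b
  column₂ = solve-∀

x⊗y≡z⇒y≡x⁻¹⊗z : ∀ A B {C} → det A ≡ 1ℤ → A ⊗ B ≡ C → B ≡ inv A ⊗ C
x⊗y≡z⇒y≡x⁻¹⊗z A B detA≡1 AB≡C =
  trans (sym (inv-⊗-cancelˡ A B detA≡1)) (cong (inv A ⊗_) AB≡C)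

x⊗y≡z⇒x≡z⊗y⁻¹ : ∀ A B {C} → det B ≡ 1ℤ → A ⊗ B ≡ C → A ≡ C ⊗ inv B
x⊗y≡z⇒x≡z⊗y⁻¹ A B detB≡1 AB≡C =
  trans (sym (⊗-inv-cancelʳ A B detB≡1)) (cong (_⊗ inv B) AB≡C)

tr-⊗-comm : ∀ A B → tr (A ⊗ B) ≡ tr (B ⊗ A)
tr-⊗-comm (mat a b c d) (mat e f g h) = trace-identity a b c d e f g h
  where
  trace-identity : ∀ a b c d e f g h →
                   a * e + b * g + (c * f + d * h) ≡ e * a + f * c + (g * b + h * d)
  trace-identity = solve-∀

tr-conj : ∀ A B → det A ≡ 1ℤ → tr (A ⊗ B ⊗ inv A) ≡ tr B
tr-conj A B detA≡1 = begin
  tr (A ⊗ B ⊗ inv A)      ≡⟨ tr-⊗-comm (A ⊗ B) (inv A) ⟩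
  tr (inv A ⊗ (A ⊗ B))    ≡⟨ cong tr (inv-⊗-cancelˡ A B detA≡1) ⟩
  tr B                    ∎

tr-inv-conj : ∀ A B → det A ≡ 1ℤ → tr (inv A ⊗ B ⊗ A) ≡ tr B
tr-inv-conj A B detA≡1 = begin
  tr (inv A ⊗ B ⊗ A)      ≡⟨ cong tr (⊗-assoc (inv A) B A) ⟩
  tr (inv A ⊗ (B ⊗ A))    ≡⟨ tr-⊗-comm (inv A) (B ⊗ A) ⟩
  tr (B ⊗ A ⊗ inv A)      ≡⟨ cong tr (⊗-inv-cancelʳ B A detA≡1) ⟩
  tr B                    ∎

B⊗C⊗B⁻¹≡A⁻¹⊗T⊗B⁻¹ : ∀ A B C {T} → det A ≡ 1ℤ → A ⊗ B ⊗ C ≡ T →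
                      B ⊗ C ⊗ inv B ≡ inv A ⊗ T ⊗ inv B
B⊗C⊗B⁻¹≡A⁻¹⊗T⊗B⁻¹ A B C detA≡1 ABC≡T =
  cong (_⊗ inv B) (x⊗y≡z⇒y≡x⁻¹⊗z A (B ⊗ C) detA≡1 (trans (sym (⊗-assoc A B C)) ABC≡T))

B⁻¹⊗A⊗B≡B⁻¹⊗T⊗C⁻¹ : ∀ A B C {T} → det C ≡ 1ℤ → A ⊗ B ⊗ C ≡ T →
                      inv B ⊗ A ⊗ B ≡ inv B ⊗ T ⊗ inv C
B⁻¹⊗A⊗B≡B⁻¹⊗T⊗C⁻¹ A B C {T} detC≡1 ABC≡T = begin
  inv B ⊗ A ⊗ B          ≡⟨ ⊗-assoc (inv B) A B ⟩
  inv B ⊗ (A ⊗ B)        ≡⟨ cong (inv B ⊗_) (x⊗y≡z⇒x≡z⊗y⁻¹ (A ⊗ B) C detC≡1 ABC≡T) ⟩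
  inv B ⊗ (T ⊗ inv C)    ≡⟨ ⊗-assoc (inv B) T (inv C) ⟨
  inv B ⊗ T ⊗ inv C      ∎

-- ψ, S and T with an arbitrary integer κ in place of + k: at κ = + k they unfold
-- to ψ k, Smat k and Tmat k.  The entry identities below quantify κ again, since
-- solve-∀ treats only bound variables as indeterminates.
module _ (κ : ℤ) where

  ψℤ : Mat2 → Mat2
  ψℤ (mat a b c d) =
    mat (- a + b * κ - κ)
        b
        (c - (κ + + 3) * a + κ * (+ 2 * κ + + 3) * (b - 1ℤ))
        (- d + (+ 2 * κ + + 3) * b - κ)

  Sℤ Tℤ L R : Mat2
  Sℤ = mat κ 0ℤ (+ 3 * κ * κ + + 3 * κ) κ
  Tℤ = mat (- 1ℤ) 0ℤ (+ 3 * κ + + 3) (- 1ℤ)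
  L = mat 1ℤ 0ℤ (+ 2 * κ + + 3) (- 1ℤ)
  R = mat (- 1ℤ) 0ℤ κ 1ℤ

  twist : Mat2 → Mat2
  twist M = L ⊗ M ⊗ R

  twist-mat : ∀ a b c d → twist (mat a b c d) ≡
              mat (b * κ - a)
                  b
                  (((+ 2 * κ + + 3) * b - d) * κ - ((+ 2 * κ + + 3) * a - c))
                  ((+ 2 * κ + + 3) * b - d)
  twist-mat a b c d =
    mat-cong (entry₁₁ κ a b c d) (entry₁₂ a b c d) (entry₂₁ κ a b c d) (entry₂₂ κ a b c d)
    where
    entry₁₁ : ∀ κ a b c d → (1ℤ * a + 0ℤ * c) * - 1ℤ + (1ℤ * b + 0ℤ * d) * κ ≡ b * κ - a
    entry₁₁ = solve-∀
    entry₁₂ : ∀ a b c d → (1ℤ * a + 0ℤ * c) * 0ℤ + (1ℤ * b + 0ℤ * d) * 1ℤ ≡ b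
    entry₁₂ = solve-∀
    entry₂₁ : ∀ κ a b c d →
      ((+ 2 * κ + + 3) * a + - 1ℤ * c) * - 1ℤ + ((+ 2 * κ + + 3) * b + - 1ℤ * d) * κ
        ≡ ((+ 2 * κ + + 3) * b - d) * κ - ((+ 2 * κ + + 3) * a - c)
    entry₂₁ = solve-∀
    entry₂₂ : ∀ κ a b c d →
      ((+ 2 * κ + + 3) * a + - 1ℤ * c) * 0ℤ + ((+ 2 * κ + + 3) * b + - 1ℤ * d) * 1ℤ
        ≡ (+ 2 * κ + + 3) * b - d
    entry₂₂ = solve-∀

  R⊗L≡T : R ⊗ L ≡ Tℤ
  R⊗L≡T = mat-cong refl refl (entry₂₁ κ) (entry₂₂ κ)
    where
    entry₂₁ : ∀ κ → κ * 1ℤ + 1ℤ * (+ 2 * κ + + 3) ≡ + 3 * κ + + 3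
    entry₂₁ = solve-∀
    entry₂₂ : ∀ κ → κ * 0ℤ + 1ℤ * - 1ℤ ≡ - 1ℤ
    entry₂₂ = solve-∀

  twist-⊗ : ∀ A B → twist A ⊗ twist B ≡ twist (A ⊗ Tℤ ⊗ B)
  twist-⊗ A B = begin
    L ⊗ A ⊗ R ⊗ (L ⊗ B ⊗ R)    ≡⟨ ⊗-assoc (L ⊗ A ⊗ R) (L ⊗ B) R ⟨
    L ⊗ A ⊗ R ⊗ (L ⊗ B) ⊗ R    ≡⟨ cong (_⊗ R) (⊗-assoc (L ⊗ A ⊗ R) L B) ⟨
    L ⊗ A ⊗ R ⊗ L ⊗ B ⊗ R      ≡⟨ cong (λ X → X ⊗ B ⊗ R) (⊗-assoc (L ⊗ A) R L) ⟩
    L ⊗ A ⊗ (R ⊗ L) ⊗ B ⊗ R    ≡⟨ cong (λ X → L ⊗ A ⊗ X ⊗ B ⊗ R) R⊗L≡T ⟩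
    L ⊗ A ⊗ Tℤ ⊗ B ⊗ R         ≡⟨ cong (λ X → X ⊗ B ⊗ R) (⊗-assoc L A Tℤ) ⟩
    L ⊗ (A ⊗ Tℤ) ⊗ B ⊗ R       ≡⟨ cong (_⊗ R) (⊗-assoc L (A ⊗ Tℤ) B) ⟩
    L ⊗ (A ⊗ Tℤ ⊗ B) ⊗ R       ∎

  trace-slice-elim : (P : Mat2 → Set) → (∀ a b c → P (mat a b c (- κ - a))) →
                     ∀ {M} → tr M ≡ - κ → P M
  trace-slice-elim P p {mat a b c d} a+d≡-κ =
    subst (λ x → P (mat a b c x)) (trans (cong (_- a) (sym a+d≡-κ)) (a+d-a≡d a d)) (p a b c)
    where
    a+d-a≡d : ∀ a d → a + d - a ≡ d
    a+d-a≡d = solve-∀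

  ψ-on-trace-slice : ∀ {M} → tr M ≡ - κ → ψℤ M ≡ twist M ⊖ Sℤ
  ψ-on-trace-slice = trace-slice-elim (λ M → ψℤ M ≡ twist M ⊖ Sℤ) λ a b c →
    trans (mat-cong (entry₁₁ κ a b) (entry₁₂ b) (entry₂₁ κ a b c) (entry₂₂ κ a b))
          (cong (_⊖ Sℤ) (sym (twist-mat a b c (- κ - a))))
    where
    entry₁₁ : ∀ κ a b → - a + b * κ - κ ≡ b * κ - a - κ
    entry₁₁ = solve-∀
    entry₁₂ : ∀ b → b ≡ b - 0ℤ
    entry₁₂ = solve-∀
    entry₂₁ : ∀ κ a b c →
      c - (κ + + 3) * a + κ * (+ 2 * κ + + 3) * (b - 1ℤ)
        ≡ ((+ 2 * κ + + 3) * b - (- κ - a)) * κ - ((+ 2 * κ + + 3) * a - c)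
          - (+ 3 * κ * κ + + 3 * κ)
    entry₂₁ = solve-∀
    entry₂₂ : ∀ κ a b →
      - (- κ - a) + (+ 2 * κ + + 3) * b - κ ≡ (+ 2 * κ + + 3) * b - (- κ - a) - κ
    entry₂₂ = solve-∀

  ψ-on-trace-slice-inv : ∀ {M} → tr M ≡ - κ → ψℤ M ≡ ⊝ twist (inv M)
  ψ-on-trace-slice-inv = trace-slice-elim (λ M → ψℤ M ≡ ⊝ twist (inv M)) λ a b c →
    trans (mat-cong (entry₁₁ κ a b) (entry₁₂ b) (entry₂₁ κ a b c) (entry₂₂ κ a b))
          (cong ⊝_ (sym (twist-mat (- κ - a) (- b) (- c) a)))
    where
    entry₁₁ : ∀ κ a b → - a + b * κ - κ ≡ - (- b * κ - (- κ - a))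
    entry₁₁ = solve-∀
    entry₁₂ : ∀ b → b ≡ - - b
    entry₁₂ = solve-∀
    entry₂₁ : ∀ κ a b c →
      c - (κ + + 3) * a + κ * (+ 2 * κ + + 3) * (b - 1ℤ)
        ≡ - (((+ 2 * κ + + 3) * - b - a) * κ - ((+ 2 * κ + + 3) * (- κ - a) - - c))
    entry₂₁ = solve-∀
    entry₂₂ : ∀ κ a b → - (- κ - a) + (+ 2 * κ + + 3) * b - κ ≡ - ((+ 2 * κ + + 3) * - b - a)
    entry₂₂ = solve-∀

  ψ-inv-T-inv : ∀ A B M → tr A ≡ - κ → tr B ≡ - κ → tr M ≡ - κ →
                M ≡ inv A ⊗ Tℤ ⊗ inv B → ψℤ M ≡ ψℤ A ⊗ ψℤ B ⊖ Sℤ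
  ψ-inv-T-inv A B M trA trB trM M≡ = begin
    ψℤ M                                        ≡⟨ ψ-on-trace-slice trM ⟩
    twist M ⊖ Sℤ                                ≡⟨ cong (λ N → twist N ⊖ Sℤ) M≡ ⟩
    twist (inv A ⊗ Tℤ ⊗ inv B) ⊖ Sℤ             ≡⟨ cong (_⊖ Sℤ) (twist-⊗ (inv A) (inv B)) ⟨
    twist (inv A) ⊗ twist (inv B) ⊖ Sℤ          ≡⟨ cong (_⊖ Sℤ) (⊝-⊗-⊝ (twist (inv A)) (twist (inv B))) ⟨
    ⊝ twist (inv A) ⊗ ⊝ twist (inv B) ⊖ Sℤ      ≡⟨ cong₂ (λ U V → U ⊗ V ⊖ Sℤ) ψA ψB ⟨
    ψℤ A ⊗ ψℤ B ⊖ Sℤ                            ∎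
    where
    ψA : ψℤ A ≡ ⊝ twist (inv A)
    ψA = ψ-on-trace-slice-inv trA
    ψB : ψℤ B ≡ ⊝ twist (inv B)
    ψB = ψ-on-trace-slice-inv trB

lemma5p7 : (k : ℕ) (X Y Z : Mat2) → IsMMTriple k X Y Z →
    ((ψ k X , ψ k (Y ⊗ Z ⊗ inv Y) , ψ k Y) ≡ (ψ k X , ψ k X ⊗ ψ k Y ⊖ Smat k , ψ k Y))
    × ((ψ k Y , ψ k (inv Y ⊗ X ⊗ Y) , ψ k Z) ≡ (ψ k Y , ψ k Y ⊗ ψ k Z ⊖ Smat k , ψ k Z))
lemma5p7 k X Y Z ((detX , _ , trX) , (detY , _ , trY) , (detZ , _ , trZ) , XYZ≡T , _) =
  cong (λ W → ψ k X , W , ψ k Y)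
       (ψ-inv-T-inv (+ k) X Y (Y ⊗ Z ⊗ inv Y) trX trY (trans (tr-conj Y Z detY) trZ)
                    (B⊗C⊗B⁻¹≡A⁻¹⊗T⊗B⁻¹ X Y Z detX XYZ≡T)) ,
  cong (λ W → ψ k Y , W , ψ k Z)
       (ψ-inv-T-inv (+ k) Y Z (inv Y ⊗ X ⊗ Y) trY trZ (trans (tr-inv-conj Y X detY) trX)
                    (B⁻¹⊗A⊗B≡B⁻¹⊗T⊗C⁻¹ X Y Z detZ XYZ≡T))
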